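{- Let $p\ge 3$ be a prime, $m\ge 1$ an integer and $i\in\{0,\dots,m\}$. Then $$\binom{pm}{pi}\equiv\binom{m}{i}\pmod{p^{\nu_p(m)+\nu_p\left(\binom{m}{i}\right)+3-\chi}},$$ where $\chi=[p=3]-\left[p=3,\ \nu_3(m)\ge 1,\ \nu_3\!\left(\binom{m}{i}\right)=0\right]$.
   Context: $\nu_p$ denotes the $p$-adic valuation. For a logical condition $A$, $[A]$ equals $1$ if $A$ holds and $0$ otherwise; $[A,B,C]$ equals $1$ if all of $A,B,C$ hold and $0$ otherwise. -}

module Defs where

open import Data.Nat using (ℕ; zero; suc; _+_; _∸_; _^_; _≤_; _≡ᵇ_)
open import Data.Nat.Divisibility using (_∣_)
open import Data.Bool using (Bool; true; false; if_then_else_; _∧_; not)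
open import Relation.Nullary using (¬_)

IsValuation : ℕ → ℕ → ℕ → Set
IsValuation p n a = (p ^ a ∣ n) × ¬ (p ^ suc a ∣ n)
  where open import Data.Product using (_×_)

iv : Bool → ℕ
iv true = 1
iv false = 0

-- χ = [p=3] - [p=3, ν₃(m) ≥ 1, ν₃(C(m,i)) = 0], given a = ν_p(m), b = ν_p(C(m,i)).
-- The subtraction is in ℕ but never truncates (the second bracket implies the first).
chi : (p a b : ℕ) → ℕ
chi p a b = iv (p ≡ᵇ 3) ∸ iv ((p ≡ᵇ 3) ∧ not (a ≡ᵇ 0) ∧ (b ≡ᵇ 0))

infix 4 _≡_[mod_]
_≡_[mod_] : ℕ → ℕ → ℕ → Set
x ≡ y [mod n ] = Data.Integer.Divisibility._∣_ (Data.Integer.+_ n) (Data.Integer._-_ (Data.Integer.+_ x) (Data.Integer.+_ y))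
  where import Data.Integer
        import Data.Integer.Divisibility

{-# OPTIONS --safe #-}

-- Write (pn)! = pⁿ · n! · F(n) with F(n) = V(0) ⋯ V(n − 1), V(j) = (jp + 1)(jp + 2) ⋯ (jp + p − 1).
-- For m = i + k this gives C(pm, pi) · F(i) F(k) = C(m, i) · F(m), and F is prime to p, so it
-- suffices to show p^e ∣ F(m) − F(i) F(k); by telescoping, it suffices that p^e ∣ V(j) − V(l)
-- whenever j + l + 1 = m. Pairing the factors jp + s and jp + p − s writes V(j) as a polynomial in
-- w = x(x + p), x = jp, which is invariant under j ↦ −1 − j. Hence V(j) − V(l) is congruent to
-- (w(j) − w(l)) · L modulo (w(j) − w(l)) · p, where w(j) − w(l) = p²(j − l)(j + l + 1) and L is the
-- linear coefficient of that polynomial. For p ≥ 5, L ≡ 0 (mod p): up to a unit it is the sum of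
-- the inverse squares modulo p, which is a permutation of the sum of the squares. For p = 3 one
-- power is lost; when 3 ∣ m and 3 ∤ C(m, i), also 3 ∣ i and 3 ∣ k, and grouping the blocks in
-- threes recovers it.

module Submission where

open import Defs
open import Data.Nat.Base as ℕ using (ℕ; zero; suc; _!; s≤s; z≤n)
import Data.Nat.Properties as ℕ
import Data.Nat.Divisibility as ℕ
open import Data.Nat.Primality using (Prime; euclidsLemma; prime⇒nonZero; prime⇒nonTrivial; prime⇒irreducible)
open import Data.Product using (_,_; ∃)
open import Data.Sum using (_⊎_; inj₁; inj₂; [_,_]′)
open import Data.Empty using (⊥-elim)
open import Function using (_∘_; id)
open import Data.Fin.Base using (Fin; toℕ; fromℕ<)
import Data.Fin.Properties as Fin
open import Data.Fin.Permutation using (permutation)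
open import Relation.Nullary using (¬_)
open import Relation.Binary.PropositionalEquality
open import Data.Nat.Combinatorics using (_C_; nCk≡n!/k![n-k]!; k![n∸k]!∣n!)
open import Data.Nat.DivMod using (_%_; _/_; m/n*n≡m; m*[n/m]≡n; m%n<n; m≡m%n+[m/n]*n)
open import Data.Nat.Properties using (_!≢0; _!*_!≢0)

module _ where
  open import Data.Integer.Base as ℤ using (ℤ; +_; _+_; _*_; _-_; -_; _^_; 0ℤ; 1ℤ)
  import Data.Integer.Properties as ℤ
  open import Data.Integer.Divisibility.Signed
  open import Data.Integer.Tactic.RingSolver using (solve-∀)

  ∏ : ℕ → (ℕ → ℤ) → ℤ
  ∏ zero    f = 1ℤ
  ∏ (suc n) f = f 0 * ∏ n (f ∘ suc)

  ∑ : ℕ → (ℕ → ℤ) → ℤ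
  ∑ zero    f = 0ℤ
  ∑ (suc n) f = f 0 + ∑ n (f ∘ suc)

  ∏-last : ∀ n f → ∏ (suc n) f ≡ ∏ n f * f n
  ∏-last zero    f = ℤ.*-comm (f 0) 1ℤ
  ∏-last (suc n) f = trans (cong (f 0 *_) (∏-last n (f ∘ suc))) (sym (ℤ.*-assoc (f 0) _ _))

  ∑-last : ∀ n f → ∑ (suc n) f ≡ ∑ n f + f n
  ∑-last zero    f = ℤ.+-comm (f 0) 0ℤ
  ∑-last (suc n) f = trans (cong (λ t → f 0 + t) (∑-last n (f ∘ suc))) (sym (ℤ.+-assoc (f 0) _ _))

  ∏-cong : ∀ n {f g} → (∀ s → f s ≡ g s) → ∏ n f ≡ ∏ n g
  ∏-cong zero    f≗g = refl
  ∏-cong (suc n) f≗g = cong₂ _*_ (f≗g 0) (∏-cong n (f≗g ∘ suc))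

  ∑-cong : ∀ n {f g} → (∀ s → s ℕ.< n → f s ≡ g s) → ∑ n f ≡ ∑ n g
  ∑-cong zero    f≗g = refl
  ∑-cong (suc n) f≗g = cong₂ _+_ (f≗g 0 (s≤s z≤n)) (∑-cong n (λ s s<n → f≗g (suc s) (s≤s s<n)))

  ∏-cong-∣ : ∀ {M} n {f g} → (∀ s → M ∣ f s - g s) → M ∣ ∏ n f - ∏ n g
  ∏-cong-∣ zero    f≡g = divides 0ℤ refl
  ∏-cong-∣ (suc n) {f} {g} f≡g =
    subst (_ ∣_) (step (f 0) (g 0) (∏ n (f ∘ suc)) (∏ n (g ∘ suc)))
      (∣m∣n⇒∣m+n (∣m⇒∣m*n _ (f≡g 0)) (∣n⇒∣m*n (g 0) (∏-cong-∣ n (f≡g ∘ suc))))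
    where
    step : ∀ a b x y → (a - b) * x + b * (x - y) ≡ a * x - b * y
    step = solve-∀

  ∑-fold : ∀ n f → ∑ (n ℕ.* 2) f ≡ ∑ n (λ s → f s + f (n ℕ.* 2 ℕ.∸ suc s))
  ∑-fold zero    f = refl
  ∑-fold (suc n) f = begin
    f 0 + ∑ (suc (n ℕ.* 2)) (f ∘ suc)
      ≡⟨ cong (λ t → f 0 + t) (∑-last (n ℕ.* 2) (f ∘ suc)) ⟩
    f 0 + (∑ (n ℕ.* 2) (f ∘ suc) + f (suc (n ℕ.* 2)))
      ≡⟨ cong (λ t → f 0 + (t + f (suc (n ℕ.* 2)))) (∑-fold n (f ∘ suc)) ⟩
    f 0 + (∑ n (λ s → f (suc s) + f (suc (n ℕ.* 2 ℕ.∸ suc s))) + f (suc (n ℕ.* 2)))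
      ≡⟨ swap (f 0) _ (f (suc (n ℕ.* 2))) ⟩
    f 0 + f (suc (n ℕ.* 2)) + ∑ n (λ s → f (suc s) + f (suc (n ℕ.* 2 ℕ.∸ suc s)))
      ≡⟨ cong (λ t → f 0 + f (suc (n ℕ.* 2)) + t) (∑-cong n reflect) ⟩
    f 0 + f (suc (n ℕ.* 2)) + ∑ n (λ s → f (suc s) + f (n ℕ.* 2 ℕ.∸ s))
      ∎
    where
    open ≡-Reasoning
    swap : ∀ a x b → a + (x + b) ≡ a + b + x
    swap = solve-∀
    reflect : ∀ s → s ℕ.< n → f (suc s) + f (suc (n ℕ.* 2 ℕ.∸ suc s)) ≡ f (suc s) + f (n ℕ.* 2 ℕ.∸ s)
    reflect s s<n = cong (λ t → f (suc s) + f t)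
      (sym (ℕ.+-∸-assoc 1 (ℕ.≤-trans s<n (ℕ.m≤m*n n 2))))

  ∑-squares : ∀ n → + 6 * ∑ (suc n) (λ s → + s * + s) ≡ + n * + suc n * (+ n + + suc n)
  ∑-squares zero    = refl
  ∑-squares (suc n) = begin
    + 6 * ∑ (suc (suc n)) square
      ≡⟨ cong (+ 6 *_) (∑-last (suc n) square) ⟩
    + 6 * (∑ (suc n) square + + suc n * + suc n)
      ≡⟨ ℤ.*-distribˡ-+ (+ 6) (∑ (suc n) square) _ ⟩
    + 6 * ∑ (suc n) square + + 6 * (+ suc n * + suc n)
      ≡⟨ cong (λ t → t + + 6 * (+ suc n * + suc n)) (∑-squares n) ⟩
    + n * + suc n * (+ n + + suc n) + + 6 * (+ suc n * + suc n)
      ≡⟨ closedForm (+ n) ⟩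
    + suc n * + suc (suc n) * (+ suc n + + suc (suc n))
      ∎
    where
    open ≡-Reasoning
    square : ℕ → ℤ
    square s = + s * + s
    closedForm : ∀ x → x * (+ 1 + x) * (x + (+ 1 + x)) + + 6 * ((+ 1 + x) * (+ 1 + x))
                     ≡ (+ 1 + x) * (+ 2 + x) * ((+ 1 + x) + (+ 2 + x))
    closedForm = solve-∀

  ∑-involution : ∀ n (σ : ℕ → ℕ) → (∀ s → s ℕ.< n → σ s ℕ.< n) → (∀ s → s ℕ.< n → σ (σ s) ≡ s) →
                 ∀ f → ∑ n (f ∘ σ) ≡ ∑ n f
  ∑-involution n σ σ< σσ f = begin
    ∑ n (f ∘ σ)             ≡⟨ ∑≡sum n (f ∘ σ) ⟩
    sum {n} (f ∘ σ ∘ toℕ)   ≡⟨ sum-cong-≗ (cong f ∘ toℕ-τ) ⟨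
    sum {n} (f ∘ toℕ ∘ τ)   ≡⟨ sum-permute (f ∘ toℕ) (permutation τ τ ττ ττ) ⟨
    sum {n} (f ∘ toℕ)       ≡⟨ ∑≡sum n f ⟨
    ∑ n f                   ∎
    where
    open ≡-Reasoning
    open import Algebra.Properties.CommutativeMonoid.Sum ℤ.+-0-commutativeMonoid using (sum; sum-cong-≗; sum-permute)
    ∑≡sum : ∀ n f → ∑ n f ≡ sum {n} (f ∘ toℕ)
    ∑≡sum zero    f = refl
    ∑≡sum (suc n) f = cong (λ t → f 0 + t) (∑≡sum n (f ∘ suc))
    τ : Fin n → Fin n
    τ i = fromℕ< (σ< (toℕ i) (Fin.toℕ<n i))
    toℕ-τ : ∀ i → toℕ (τ i) ≡ σ (toℕ i)
    toℕ-τ i = Fin.toℕ-fromℕ< _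
    ττ : ∀ i → τ (τ i) ≡ i
    ττ i = Fin.toℕ-injective (trans (toℕ-τ (τ i)) (trans (cong σ (toℕ-τ i)) (σσ (toℕ i) (Fin.toℕ<n i))))

  pos-^ : ∀ m n → + (m ℕ.^ n) ≡ (+ m) ^ n
  pos-^ m zero    = refl
  pos-^ m (suc n) = trans (ℤ.pos-* m (m ℕ.^ n)) (cong (+ m *_) (pos-^ m n))

  ∣-<⇒≡ : ∀ {p a b} → a ℕ.< p → b ℕ.< p → + p ∣ + a - + b → a ≡ b
  ∣-<⇒≡ {p} {a} {b} a<p b<p p∣a-b with ℤ.∣ + a - + b ∣ in eq
  ... | zero  = ℤ.+-injective (ℤ.i-j≡0⇒i≡j (+ a) (+ b) (ℤ.∣i∣≡0⇒i≡0 eq))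
  ... | suc t = ⊥-elim (ℕ.>⇒∤ ∣a-b∣<p (subst (p ℕ.∣_) eq (∣⇒∣ᵤ p∣a-b)))
    where
    ∣a-b∣<p : suc t ℕ.< p
    ∣a-b∣<p = begin-strict
      suc t            ≡⟨ eq ⟨
      ℤ.∣ + a - + b ∣  ≡⟨ cong ℤ.∣_∣ (ℤ.[+m]-[+n]≡m⊖n a b) ⟩
      ℤ.∣ a ℤ.⊖ b ∣    ≤⟨ ℤ.∣m⊝n∣≤m⊔n a b ⟩
      a ℕ.⊔ b          <⟨ ℕ.⊔-pres-<m a<p b<p ⟩
      p                ∎
      where open ℕ.≤-Reasoning

  module _ {p} (pp : Prime p) where

    euclidsLemmaℤ : ∀ x y → + p ∣ x * y → + p ∣ x ⊎ + p ∣ y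
    euclidsLemmaℤ x y p∣xy with euclidsLemma ℤ.∣ x ∣ ℤ.∣ y ∣ pp (subst (p ℕ.∣_) (ℤ.abs-* x y) (∣⇒∣ᵤ p∣xy))
    ... | inj₁ p∣x = inj₁ (∣ᵤ⇒∣ p∣x)
    ... | inj₂ p∣y = inj₂ (∣ᵤ⇒∣ p∣y)

    ∤*∤⇒∤ : ∀ {x y} → ¬ + p ∣ x → ¬ + p ∣ y → ¬ + p ∣ x * y
    ∤*∤⇒∤ {x} {y} p∤x p∤y p∣xy with euclidsLemmaℤ x y p∣xy
    ... | inj₁ p∣x = p∤x p∣x
    ... | inj₂ p∣y = p∤y p∣y

    ∏-∤ : ∀ n {f} → (∀ s → s ℕ.< n → ¬ + p ∣ f s) → ¬ + p ∣ ∏ n f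
    ∏-∤ zero    _   = ℕ.>⇒∤ (ℕ.nonTrivial⇒n>1 p {{prime⇒nonTrivial pp}}) ∘ ∣⇒∣ᵤ
    ∏-∤ (suc n) p∤f = ∤*∤⇒∤ (p∤f 0 (s≤s z≤n)) (∏-∤ n (λ s s<n → p∤f (suc s) (s≤s s<n)))

    prime^∣-cancelʳ : ∀ {u} → ¬ + p ∣ u → ∀ n {x} → (+ p) ^ n ∣ x * u → (+ p) ^ n ∣ x
    prime^∣-cancelʳ p∤u zero    {x} _ = divides x (sym (ℤ.*-identityʳ x))
    prime^∣-cancelʳ {u} p∤u (suc n) {x} pⁿ⁺¹∣xu
      with euclidsLemmaℤ x u (∣-trans (∣m⇒∣m*n ((+ p) ^ n) ∣-refl) pⁿ⁺¹∣xu)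
    ... | inj₂ p∣u = ⊥-elim (p∤u p∣u)
    ... | inj₁ (divides q refl) = subst ((+ p) ^ suc n ∣_) (ℤ.*-comm (+ p) q)
            (*-monoʳ-∣ (+ p) (prime^∣-cancelʳ p∤u n
              (*-cancelˡ-∣ (+ p) (subst ((+ p) ^ suc n ∣_) (regroup q (+ p) u) pⁿ⁺¹∣xu))))
      where
      instance _ = prime⇒nonZero pp
      regroup : ∀ q p u → q * p * u ≡ p * (q * u)
      regroup = solve-∀

  telescope : ∀ (F V : ℕ → ℤ) → F 0 ≡ 1ℤ → (∀ n → F (suc n) ≡ F n * V n) →
              ∀ {M} m → (∀ j l → suc (j ℕ.+ l) ≡ m → M ∣ V j - V l) →
              ∀ i k → i ℕ.+ k ≡ m → M ∣ F m - F i * F k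
  telescope F V F0≡1 F-suc {M} m V-sym = go
    where
    go : ∀ i k → i ℕ.+ k ≡ m → M ∣ F m - F i * F k
    go zero    k refl rewrite F0≡1 = subst (M ∣_) (cancel (F k)) (divides 0ℤ refl)
      where
      cancel : ∀ a → + 0 ≡ a - + 1 * a
      cancel = solve-∀
    go (suc i) k e    = subst (M ∣_) shift
      (∣m∣n⇒∣m-n (go i (suc k) (trans (ℕ.+-suc i k) e)) (∣n⇒∣m*n (F i * F k) (V-sym i k e)))
      where
      shift : F m - F i * F (suc k) - F i * F k * (V i - V k) ≡ F m - F (suc i) * F k
      shift rewrite F-suc i | F-suc k = regroup (F m) (F i) (F k) (V i) (V k)
        where
        regroup : ∀ a b c d e → a - b * (c * e) - b * c * (d - e) ≡ a - b * d * c
        regroup = solve-∀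

  telescope-^ : ∀ (F V : ℕ → ℤ) → F 0 ≡ 1ℤ → (∀ n → F (suc n) ≡ F n * V n) →
                ∀ {p e} → (∀ j l → (1ℤ + + j + + l) * (+ p) ^ e ∣ V j - V l) →
                ∀ {a m} → p ℕ.^ a ℕ.∣ m → ∀ i k → i ℕ.+ k ≡ m → (+ p) ^ (a ℕ.+ e) ∣ F m - F i * F k
  telescope-^ F V F0≡1 F-suc {p} {e} V-sym {a} {m} pᵃ∣m = telescope F V F0≡1 F-suc m V-sym′
    where
    V-sym′ : ∀ j l → suc (j ℕ.+ l) ≡ m → (+ p) ^ (a ℕ.+ e) ∣ V j - V l
    V-sym′ j l refl = ∣-trans
      (subst (_∣ (1ℤ + + j + + l) * (+ p) ^ e) (sym (ℤ.^-distribˡ-+-* (+ p) a e))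
        (*-monoˡ-∣ ((+ p) ^ e) (subst (_∣ + m) (pos-^ p a) (∣ᵤ⇒∣ pᵃ∣m))))
      (V-sym j l)

  -- Factorials

  rising : ℤ → ℕ → ℤ
  rising x n = ∏ n (λ s → x + + suc s)

  rising-suc : ∀ x n → rising x (suc n) ≡ (x + 1ℤ) * rising (x + 1ℤ) n
  rising-suc x n = cong ((x + 1ℤ) *_) (∏-cong n (λ s → sym (ℤ.+-assoc x 1ℤ (+ suc s))))

  factorial-+ : ∀ x n → + ((x ℕ.+ n) !) ≡ + (x !) * rising (+ x) n
  factorial-+ x zero    = trans (cong (λ t → + (t !)) (ℕ.+-identityʳ x)) (sym (ℤ.*-identityʳ (+ (x !))))
  factorial-+ x (suc n) = begin
    + ((x ℕ.+ suc n) !)                        ≡⟨ cong (λ t → + (t !)) (ℕ.+-suc x n) ⟩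
    + (suc (x ℕ.+ n) ℕ.* (x ℕ.+ n) !)          ≡⟨ ℤ.pos-* (suc (x ℕ.+ n)) ((x ℕ.+ n) !) ⟩
    + suc (x ℕ.+ n) * + ((x ℕ.+ n) !)          ≡⟨ cong (+ suc (x ℕ.+ n) *_) (factorial-+ x n) ⟩
    + suc (x ℕ.+ n) * (+ (x !) * rising (+ x) n) ≡⟨ regroup (+ suc (x ℕ.+ n)) (+ (x !)) (rising (+ x) n) ⟩
    + (x !) * (rising (+ x) n * + suc (x ℕ.+ n)) ≡⟨ cong (λ t → + (x !) * (rising (+ x) n * + t)) (ℕ.+-suc x n) ⟨
    + (x !) * (rising (+ x) n * + (x ℕ.+ suc n)) ≡⟨ cong (+ (x !) *_) (∏-last n (λ s → + x + + suc s)) ⟨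
    + (x !) * rising (+ x) (suc n)             ∎
    where
    open ≡-Reasoning
    regroup : ∀ a b c → a * (b * c) ≡ b * (c * a)
    regroup = solve-∀

  block : ℕ → ℕ → ℤ
  block p j = rising (+ (p ℕ.* j)) (p ℕ.∸ 1)

  pFreeFactorial : ℕ → ℕ → ℤ
  pFreeFactorial p n = ∏ n (block p)

  factorial-p* : ∀ p .{{_ : ℕ.NonZero p}} n → + ((p ℕ.* n) !) ≡ (+ p) ^ n * + (n !) * pFreeFactorial p n
  factorial-p* (suc N) zero    = cong (λ t → + (t !)) (ℕ.*-zeroʳ N)
  factorial-p* p@(suc N) (suc n) = begin
    + ((p ℕ.* suc n) !)
      ≡⟨ cong (λ t → + (t !)) (trans (ℕ.*-suc p n) (ℕ.+-comm p (p ℕ.* n))) ⟩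
    + ((p ℕ.* n ℕ.+ p) !)
      ≡⟨ factorial-+ (p ℕ.* n) p ⟩
    + ((p ℕ.* n) !) * rising (+ (p ℕ.* n)) p
      ≡⟨ cong₂ _*_ (factorial-p* p n) (∏-last N (λ s → + (p ℕ.* n) + + suc s)) ⟩
    (+ p) ^ n * + (n !) * pFreeFactorial p n * (block p n * (+ (p ℕ.* n) + + p))
      ≡⟨ cong (λ x → (+ p) ^ n * + (n !) * pFreeFactorial p n * (block p n * (x + + p))) (ℤ.pos-* p n) ⟩
    (+ p) ^ n * + (n !) * pFreeFactorial p n * (block p n * (+ p * + n + + p))
      ≡⟨ regroup ((+ p) ^ n) (+ (n !)) (pFreeFactorial p n) (block p n) (+ p) (+ n) ⟩
    + p * (+ p) ^ n * ((+ 1 + + n) * + (n !)) * (pFreeFactorial p n * block p n)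
      ≡⟨ cong (λ t → + p * (+ p) ^ n * t * (pFreeFactorial p n * block p n)) (ℤ.pos-* (suc n) (n !)) ⟨
    (+ p) ^ suc n * + (suc n !) * (pFreeFactorial p n * block p n)
      ≡⟨ cong ((+ p) ^ suc n * + (suc n !) *_) (∏-last n (block p)) ⟨
    (+ p) ^ suc n * + (suc n !) * pFreeFactorial p (suc n)
      ∎
    where
    open ≡-Reasoning
    regroup : ∀ q f r b P x → q * f * r * (b * (P * x + P)) ≡ P * q * ((+ 1 + x) * f) * (r * b)
    regroup = solve-∀

  binomial-factorials : ∀ i k → + ((i ℕ.+ k) C i) * (+ (i !) * + (k !)) ≡ + ((i ℕ.+ k) !)
  binomial-factorials i k = begin
    + (m C i) * (+ (i !) * + (k !))  ≡⟨ cong (+ (m C i) *_) (ℤ.pos-* (i !) (k !)) ⟨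
    + (m C i) * + (i ! ℕ.* k !)      ≡⟨ ℤ.pos-* (m C i) (i ! ℕ.* k !) ⟨
    + ((m C i) ℕ.* (i ! ℕ.* k !))    ≡⟨ cong +_ (subst (λ t → (m C i) ℕ.* (i ! ℕ.* t !) ≡ m !) (ℕ.m+n∸m≡n i k) inℕ) ⟩
    + (m !)                          ∎
    where
    open ≡-Reasoning
    m = i ℕ.+ k
    i≤m = ℕ.m≤m+n i k
    instance _ = i !* (m ℕ.∸ i) !≢0
    inℕ : (m C i) ℕ.* (i ! ℕ.* (m ℕ.∸ i) !) ≡ m !
    inℕ = trans (cong (ℕ._* (i ! ℕ.* (m ℕ.∸ i) !)) (nCk≡n!/k![n-k]! i≤m)) (m/n*n≡m (k![n∸k]!∣n! i≤m))

  binomial-p* : ∀ p .{{_ : ℕ.NonZero p}} i k →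
                + ((p ℕ.* (i ℕ.+ k)) C (p ℕ.* i)) * (pFreeFactorial p i * pFreeFactorial p k)
                ≡ + ((i ℕ.+ k) C i) * pFreeFactorial p (i ℕ.+ k)
  binomial-p* p i k = ℤ.*-cancelˡ-≡ X _ _ (trans lhs (sym rhs))
    where
    open ≡-Reasoning
    F = pFreeFactorial p
    X = (+ p) ^ i * + (i !) * ((+ p) ^ k * + (k !))
    pᵐm!≢0 : ∀ m → ℤ.NonZero ((+ p) ^ m * + (m !))
    pᵐm!≢0 m = ℤ.i*j≢0 ((+ p) ^ m) (+ (m !)) {{subst ℤ.NonZero (pos-^ p m) (ℕ.m^n≢0 p m)}} {{m !≢0}}
    instance
      X≢0 : ℤ.NonZero X
      X≢0 = ℤ.i*j≢0 ((+ p) ^ i * + (i !)) ((+ p) ^ k * + (k !)) {{pᵐm!≢0 i}} {{pᵐm!≢0 k}}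
    lhs : X * (+ ((p ℕ.* (i ℕ.+ k)) C (p ℕ.* i)) * (F i * F k)) ≡ + ((p ℕ.* (i ℕ.+ k)) !)
    lhs = begin
      X * (+ ((p ℕ.* (i ℕ.+ k)) C (p ℕ.* i)) * (F i * F k))
        ≡⟨ regroup ((+ p) ^ i) (+ (i !)) ((+ p) ^ k) (+ (k !)) (+ ((p ℕ.* (i ℕ.+ k)) C (p ℕ.* i))) (F i) (F k) ⟩
      + ((p ℕ.* (i ℕ.+ k)) C (p ℕ.* i)) * ((+ p) ^ i * + (i !) * F i * ((+ p) ^ k * + (k !) * F k))
        ≡⟨ cong₂ (λ a b → + ((p ℕ.* (i ℕ.+ k)) C (p ℕ.* i)) * (a * b)) (factorial-p* p i) (factorial-p* p k) ⟨
      + ((p ℕ.* (i ℕ.+ k)) C (p ℕ.* i)) * (+ ((p ℕ.* i) !) * + ((p ℕ.* k) !))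
        ≡⟨ cong (λ t → + (t C (p ℕ.* i)) * (+ ((p ℕ.* i) !) * + ((p ℕ.* k) !))) (ℕ.*-distribˡ-+ p i k) ⟩
      + ((p ℕ.* i ℕ.+ p ℕ.* k) C (p ℕ.* i)) * (+ ((p ℕ.* i) !) * + ((p ℕ.* k) !))
        ≡⟨ binomial-factorials (p ℕ.* i) (p ℕ.* k) ⟩
      + ((p ℕ.* i ℕ.+ p ℕ.* k) !)
        ≡⟨ cong (λ t → + (t !)) (ℕ.*-distribˡ-+ p i k) ⟨
      + ((p ℕ.* (i ℕ.+ k)) !)
        ∎
      where
      regroup : ∀ a b c d e f g → a * b * (c * d) * (e * (f * g)) ≡ e * (a * b * f * (c * d * g))
      regroup = solve-∀
    rhs : X * (+ ((i ℕ.+ k) C i) * F (i ℕ.+ k)) ≡ + ((p ℕ.* (i ℕ.+ k)) !)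
    rhs = begin
      X * (+ ((i ℕ.+ k) C i) * F (i ℕ.+ k))
        ≡⟨ regroup ((+ p) ^ i) (+ (i !)) ((+ p) ^ k) (+ (k !)) (+ ((i ℕ.+ k) C i)) (F (i ℕ.+ k)) ⟩
      (+ p) ^ i * (+ p) ^ k * (+ ((i ℕ.+ k) C i) * (+ (i !) * + (k !))) * F (i ℕ.+ k)
        ≡⟨ cong₂ (λ a b → a * b * F (i ℕ.+ k)) (sym (ℤ.^-distribˡ-+-* (+ p) i k)) (binomial-factorials i k) ⟩
      (+ p) ^ (i ℕ.+ k) * + ((i ℕ.+ k) !) * F (i ℕ.+ k)
        ≡⟨ factorial-p* p (i ℕ.+ k) ⟨
      + ((p ℕ.* (i ℕ.+ k)) !)
        ∎
      where
      regroup : ∀ a b c d e f → a * b * (c * d) * (e * f) ≡ a * c * (e * (b * d)) * f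
      regroup = solve-∀

  module _ {p} (pp : Prime p) where

    block-∤ : ∀ j → ¬ + p ∣ block p j
    block-∤ j = ∏-∤ pp (p ℕ.∸ 1) (λ s s<p-1 p∣ →
      ℕ.>⇒∤ (<∸1⇒suc< p s<p-1) (ℕ.∣m+n∣m⇒∣n (∣⇒∣ᵤ p∣) (ℕ.m∣m*n j)))
      where
      <∸1⇒suc< : ∀ n {s} → s ℕ.< n ℕ.∸ 1 → suc s ℕ.< n
      <∸1⇒suc< (suc n) s<n = s≤s s<n

    pFreeFactorial-∤ : ∀ n → ¬ + p ∣ pFreeFactorial p n
    pFreeFactorial-∤ n = ∏-∤ pp n (λ j _ → block-∤ j)

    ∤[p-1]! : ¬ + p ∣ + ((p ℕ.∸ 1) !)
    ∤[p-1]! = block-∤ 0 ∘ subst (+ p ∣_) (begin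
      + ((p ℕ.∸ 1) !)                ≡⟨ factorial-+ 0 (p ℕ.∸ 1) ⟩
      + 1 * rising 0ℤ (p ℕ.∸ 1)      ≡⟨ ℤ.*-identityˡ _ ⟩
      rising 0ℤ (p ℕ.∸ 1)            ≡⟨ cong (λ t → rising (+ t) (p ℕ.∸ 1)) (ℕ.*-zeroʳ p) ⟨
      block p 0                      ∎)
      where open ≡-Reasoning

    pFree⇒binomial-congruence : ∀ {b e} i k → p ℕ.^ b ℕ.∣ (i ℕ.+ k) C i →
      (+ p) ^ e ∣ pFreeFactorial p (i ℕ.+ k) - pFreeFactorial p i * pFreeFactorial p k →
      (p ℕ.* (i ℕ.+ k)) C (p ℕ.* i) ≡ (i ℕ.+ k) C i [mod p ℕ.^ (b ℕ.+ e) ]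
    pFree⇒binomial-congruence {b} {e} i k pᵇ∣C pᵉ∣F =
      ∣⇒∣ᵤ (subst (_∣ + C₁ - + C₂) (sym (pos-^ p (b ℕ.+ e)))
      (prime^∣-cancelʳ pp (∤*∤⇒∤ pp (pFreeFactorial-∤ i) (pFreeFactorial-∤ k)) (b ℕ.+ e)
        (subst₂ _∣_ (sym (ℤ.^-distribˡ-+-* (+ p) b e)) (sym difference)
          (∣-trans (*-monoˡ-∣ ((+ p) ^ e) (subst (_∣ + C₂) (pos-^ p b) (∣ᵤ⇒∣ pᵇ∣C))) (*-monoʳ-∣ (+ C₂) pᵉ∣F)))))
      where
      instance _ = prime⇒nonZero pp
      F = pFreeFactorial p
      C₁ = (p ℕ.* (i ℕ.+ k)) C (p ℕ.* i)
      C₂ = (i ℕ.+ k) C i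
      difference : (+ C₁ - + C₂) * (F i * F k) ≡ + C₂ * (F (i ℕ.+ k) - F i * F k)
      difference = begin
        (+ C₁ - + C₂) * (F i * F k)             ≡⟨ distribʳ (+ C₁) (+ C₂) (F i * F k) ⟩
        + C₁ * (F i * F k) - + C₂ * (F i * F k) ≡⟨ cong (λ t → t - + C₂ * (F i * F k)) (binomial-p* p i k) ⟩
        + C₂ * F (i ℕ.+ k) - + C₂ * (F i * F k) ≡⟨ distribˡ (+ C₂) (F (i ℕ.+ k)) (F i * F k) ⟩
        + C₂ * (F (i ℕ.+ k) - F i * F k)        ∎
        where
        open ≡-Reasoning
        distribʳ : ∀ a b c → (a - b) * c ≡ a * c - b * c
        distribʳ = solve-∀
        distribˡ : ∀ c a b → c * a - c * b ≡ c * (a - b)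
        distribˡ = solve-∀

  -- The blocks for p ≥ 5

  pair : ℤ → ℕ → ℤ
  pair q s = + suc s * (q - + suc s)

  rising-pairing : ∀ h x → rising x (h ℕ.* 2) ≡ ∏ h (λ s → x * (x + + suc (h ℕ.* 2)) + pair (+ suc (h ℕ.* 2)) s)
  rising-pairing zero    x = refl
  rising-pairing (suc h) x = begin
    rising x (suc (suc (h ℕ.* 2)))
      ≡⟨ rising-suc x (suc (h ℕ.* 2)) ⟩
    (x + 1ℤ) * rising (x + 1ℤ) (suc (h ℕ.* 2))
      ≡⟨ cong ((x + 1ℤ) *_) (∏-last (h ℕ.* 2) (λ s → x + 1ℤ + + suc s)) ⟩
    (x + 1ℤ) * (rising (x + 1ℤ) (h ℕ.* 2) * (x + 1ℤ + q))
      ≡⟨ cong (λ t → (x + 1ℤ) * (t * (x + 1ℤ + q))) (rising-pairing h (x + 1ℤ)) ⟩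
    (x + 1ℤ) * (∏ h (λ s → (x + 1ℤ) * (x + 1ℤ + q) + pair q s) * (x + 1ℤ + q))
      ≡⟨ regroup (x + 1ℤ) (x + 1ℤ + q) _ ⟩
    (x + 1ℤ) * (x + 1ℤ + q) * ∏ h (λ s → (x + 1ℤ) * (x + 1ℤ + q) + pair q s)
      ≡⟨ cong₂ _*_ (outer x q) (∏-cong h (λ s → inner x q (+ suc s))) ⟩
    ∏ (suc h) (λ s → x * (x + (+ 2 + q)) + pair (+ 2 + q) s)
      ∎
    where
    open ≡-Reasoning
    q = + suc (h ℕ.* 2)
    regroup : ∀ a b c → a * (c * b) ≡ a * b * c
    regroup = solve-∀
    outer : ∀ x q → (x + + 1) * (x + + 1 + q) ≡ x * (x + (+ 2 + q)) + + 1 * (+ 2 + q - + 1)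
    outer = solve-∀
    inner : ∀ x q t → (x + + 1) * (x + + 1 + q) + t * (q - t) ≡ x * (x + (+ 2 + q)) + (+ 1 + t) * (+ 2 + q - (+ 1 + t))
    inner = solve-∀

  -- The coefficient of w in ∏ n (λ s → w + d s).
  linearCoefficient : ℕ → (ℕ → ℤ) → ℤ
  linearCoefficient zero    d = 0ℤ
  linearCoefficient (suc n) d = d 0 * linearCoefficient n (d ∘ suc) + ∏ n (d ∘ suc)

  ∏-difference : ∀ {M w₁ w₂} → M ∣ w₁ → M ∣ w₂ → ∀ n d →
                 (w₁ - w₂) * M ∣ ∏ n (λ s → w₁ + d s) - ∏ n (λ s → w₂ + d s) - (w₁ - w₂) * linearCoefficient n d
  ∏-difference {M} {w₁} {w₂} M∣w₁ M∣w₂ zero    d = subst ((w₁ - w₂) * M ∣_) (vanish (w₁ - w₂)) (divides 0ℤ refl)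
    where
    vanish : ∀ a → + 0 ≡ + 1 - + 1 - a * + 0
    vanish = solve-∀
  ∏-difference {M} {w₁} {w₂} M∣w₁ M∣w₂ (suc n) d = subst (_ ∣_) (expand w₁ w₂ (d 0) A B L Π)
    (∣m∣n⇒∣m+n (∣m∣n⇒∣m+n (∣n⇒∣m*n (w₂ + d 0) (∏-difference M∣w₁ M∣w₂ n (d ∘ suc)))
                          (*-monoʳ-∣ (w₁ - w₂) (∣m⇒∣m*n L M∣w₂)))
               (*-monoʳ-∣ (w₁ - w₂) (∏-cong-∣ n (λ s → subst (M ∣_) (sym (cancel w₁ (d (suc s)))) M∣w₁))))
    where
    A = ∏ n (λ s → w₁ + d (suc s))
    B = ∏ n (λ s → w₂ + d (suc s))
    L = linearCoefficient n (d ∘ suc)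
    Π = ∏ n (d ∘ suc)
    cancel : ∀ w e → w + e - e ≡ w
    cancel = solve-∀
    expand : ∀ w₁ w₂ d₀ A B L Π →
             (w₂ + d₀) * (A - B - (w₁ - w₂) * L) + (w₁ - w₂) * (w₂ * L) + (w₁ - w₂) * (A - Π)
             ≡ (w₁ + d₀) * A - (w₂ + d₀) * B - (w₁ - w₂) * (d₀ * L + Π)
    expand = solve-∀

  linearCoefficient-∑ : ∀ {M c} n d z → (∀ s → s ℕ.< n → M ∣ d s * z s - c) →
                        M ∣ c * linearCoefficient n d - ∏ n d * ∑ n z
  linearCoefficient-∑ {M} {c} zero    d z dz≡c = subst (M ∣_) (vanish c) (divides 0ℤ refl)
    where
    vanish : ∀ c → + 0 ≡ c * + 0 - + 1 * + 0
    vanish = solve-∀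
  linearCoefficient-∑ {M} {c} (suc n) d z dz≡c = subst (M ∣_) (expand c (d 0) (z 0) L Π Σ)
    (∣m∣n⇒∣m-n (∣n⇒∣m*n (d 0) (linearCoefficient-∑ n (d ∘ suc) (z ∘ suc) (λ s s<n → dz≡c (suc s) (s≤s s<n))))
               (∣n⇒∣m*n Π (dz≡c 0 (s≤s z≤n))))
    where
    L = linearCoefficient n (d ∘ suc)
    Π = ∏ n (d ∘ suc)
    Σ = ∑ n (z ∘ suc)
    expand : ∀ c d₀ z₀ L Π Σ → d₀ * (c * L - Π * Σ) - Π * (d₀ * z₀ - c) ≡ c * (d₀ * L + Π) - d₀ * Π * (z₀ + Σ)
    expand = solve-∀

  module _ {p} (pp : Prime p) where
    private
      instance _ = prime⇒nonZero pp
      K = (p ℕ.∸ 1) !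

    -- The inverse of s up to the unit (p − 1)!, which spares us Wilson's theorem; inverse 0 = 0
    -- makes it an involution of [0, p).
    inverse : ℕ → ℕ
    inverse zero        = 0
    inverse s@(suc _)   = (K / s) % p

    inverse-< : ∀ s → inverse s ℕ.< p
    inverse-< zero    = ℕ.n≢0⇒n>0 (ℕ.≢-nonZero⁻¹ p)
    inverse-< (suc s) = m%n<n (K / suc s) p

    inverse-spec : ∀ {s} → 0 ℕ.< s → s ℕ.< p → + p ∣ + s * + inverse s - + K
    inverse-spec {suc t} _ s<p = divides (- (+ s * + (q / p))) (begin
      + s * + (q % p) - + K                       ≡⟨ cong (λ x → + s * + (q % p) - x) K≡sq ⟩
      + s * + (q % p) - + s * (+ (q % p) + + (q / p) * + p) ≡⟨ collapse (+ s) (+ (q % p)) (+ (q / p)) (+ p) ⟩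
      - (+ s * + (q / p)) * + p                   ∎)
      where
      open ≡-Reasoning
      s = suc t
      q = K / s
      K≡sq : + K ≡ + s * (+ (q % p) + + (q / p) * + p)
      K≡sq = begin
        + K                                 ≡⟨ cong +_ (m*[n/m]≡n s∣K) ⟨
        + (s ℕ.* q)                         ≡⟨ ℤ.pos-* s q ⟩
        + s * + q                           ≡⟨ cong (λ x → + s * + x) (m≡m%n+[m/n]*n q p) ⟩
        + s * + (q % p ℕ.+ q / p ℕ.* p)     ≡⟨ cong (+ s *_) (ℤ.pos-+ (q % p) (q / p ℕ.* p)) ⟩
        + s * (+ (q % p) + + (q / p ℕ.* p)) ≡⟨ cong (λ x → + s * (+ (q % p) + x)) (ℤ.pos-* (q / p) p) ⟩
        + s * (+ (q % p) + + (q / p) * + p) ∎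
        where
        <⇒≤∸1 : ∀ n {m} → m ℕ.< n → m ℕ.≤ n ℕ.∸ 1
        <⇒≤∸1 (suc n) (s≤s m≤n) = m≤n
        s∣K : s ℕ.∣ K
        s∣K = ℕ.∣-trans (ℕ.m∣m*n (t !)) (ℕ.m≤n⇒m!∣n! (<⇒≤∸1 p s<p))
      collapse : ∀ s a b p → s * a - s * (a + b * p) ≡ - (s * b) * p
      collapse = solve-∀

    inverse-pos : ∀ {s} → 0 ℕ.< s → s ℕ.< p → 0 ℕ.< inverse s
    inverse-pos {s} 0<s s<p = ℕ.n≢0⇒n>0 (λ σs≡0 → ∤[p-1]! pp
      (subst (+ p ∣_) (negate (+ s) (+ K)) (∣m⇒∣-m (subst (λ v → + p ∣ + s * + v - + K) σs≡0 (inverse-spec 0<s s<p)))))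
      where
      negate : ∀ s K → - (s * + 0 - K) ≡ K
      negate = solve-∀

    inverse-involutive : ∀ s → s ℕ.< p → inverse (inverse s) ≡ s
    inverse-involutive zero      _   = refl
    inverse-involutive (suc t) s<p = ∣-<⇒≡ (inverse-< σs) s<p p∣σσs-s
      where
      s σs σσs : ℕ
      s = suc t
      σs = inverse s
      σσs = inverse σs
      0<σs : 0 ℕ.< σs
      0<σs = inverse-pos (s≤s z≤n) s<p
      factor : ∀ v w s K → v * w - K - (s * v - K) ≡ (w - s) * v
      factor = solve-∀
      p∣[σσs-s]σs : + p ∣ (+ σσs - + s) * + σs
      p∣[σσs-s]σs = subst (+ p ∣_) (factor (+ σs) (+ σσs) (+ s) (+ K))
                       (∣m∣n⇒∣m-n (inverse-spec 0<σs (inverse-< s)) (inverse-spec (s≤s z≤n) s<p))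
      p∣σσs-s : + p ∣ + σσs - + s
      p∣σσs-s = [ id , (λ p∣σs → ⊥-elim (ℕ.>⇒∤ {{ℕ.>-nonZero 0<σs}} (inverse-< s) (∣⇒∣ᵤ p∣σs))) ]′
                  (euclidsLemmaℤ pp (+ σσs - + s) (+ σs) p∣[σσs-s]σs)

    p∣∑-squares : 5 ℕ.≤ p → + p ∣ ∑ p (λ s → + s * + s)
    p∣∑-squares 5≤p with euclidsLemmaℤ pp (+ 6) (∑ p (λ s → + s * + s)) p∣6∑
      where
      p∣6∑ : + p ∣ + 6 * ∑ p (λ s → + s * + s)
      p∣6∑ = subst (λ n → + n ∣ + 6 * ∑ n (λ s → + s * + s)) (ℕ.suc-pred p)
        (subst (+ suc (p ℕ.∸ 1) ∣_) (sym (∑-squares (p ℕ.∸ 1))) (∣m⇒∣m*n _ (∣n⇒∣m*n (+ (p ℕ.∸ 1)) ∣-refl)))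
    ... | inj₂ p∣∑ = p∣∑
    ... | inj₁ p∣6 with euclidsLemma 2 3 pp (∣⇒∣ᵤ p∣6)
    ...   | inj₁ p∣2 = ⊥-elim (ℕ.>⇒∤ (ℕ.<-trans (s≤s (s≤s (s≤s z≤n))) 5≤p) p∣2)
    ...   | inj₂ p∣3 = ⊥-elim (ℕ.>⇒∤ (ℕ.<-trans (s≤s (s≤s (s≤s (s≤s z≤n)))) 5≤p) p∣3)

    ∑-inverse-squares : 5 ℕ.≤ p → + p ∣ ∑ p (λ s → + inverse s * + inverse s)
    ∑-inverse-squares 5≤p =
      subst (+ p ∣_) (sym (∑-involution p inverse (λ s _ → inverse-< s) inverse-involutive (λ s → + s * + s))) (p∣∑-squares 5≤p)

  module _ {h} (pp : Prime (suc (h ℕ.* 2))) (2≤h : 2 ℕ.≤ h) where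
    private
      p = suc (h ℕ.* 2)
      K = (h ℕ.* 2) !
      σ = inverse pp
      σ² : ℕ → ℤ
      σ² t = + σ t * + σ t
      z : ℕ → ℤ
      z s = σ² (suc s) + σ² (suc (h ℕ.* 2 ℕ.∸ suc s))
      c : ℤ
      c = - (+ 2 * (+ K * + K))

      p∣∑z : + p ∣ ∑ h z
      p∣∑z = subst (+ p ∣_) (trans (ℤ.+-identityˡ _) (∑-fold h (σ² ∘ suc)))
        (∑-inverse-squares pp (s≤s (ℕ.*-monoˡ-≤ 2 2≤h)))

      -- Modulo p, pair s ≡ −s² ≡ −(p − s)², so z s ≡ c / pair s, while ∑ z runs over all the inverse squares.
      pair*z≡c : ∀ s → s ℕ.< h → + p ∣ pair (+ p) s * z s - c
      pair*z≡c s s<h = subst (+ p ∣_) (sym (identity (+ p) (+ suc s) (+ σ (suc s)) (+ σ s′) (+ K)))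
        (∣m⇒∣-m (∣m∣n⇒∣m-n (∣m∣n⇒∣m+n (∣m⇒∣m*n (a * u + + K) (inverse-spec pp (s≤s z≤n) s<p))
                                      (∣m⇒∣m*n ((+ p - a) * v + + K) (subst (λ x → + p ∣ x * v - + K) +s′≡p-s
                                                                        (inverse-spec pp (s≤s z≤n) s′<p))))
                           (∣n⇒∣m*n (a * u * u + (+ p - a) * v * v) ∣-refl)))
        where
        s′ = suc (h ℕ.* 2 ℕ.∸ suc s)
        a = + suc s
        u = + σ (suc s)
        v = + σ s′
        s<h*2 : suc s ℕ.≤ h ℕ.* 2
        s<h*2 = ℕ.≤-trans s<h (ℕ.m≤m*n h 2)
        s<p : suc s ℕ.< p
        s<p = s≤s s<h*2
        s′≡p-s : s′ ≡ p ℕ.∸ suc s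
        s′≡p-s = sym (ℕ.+-∸-assoc 1 s<h*2)
        s′<p : s′ ℕ.< p
        s′<p = s≤s (subst (ℕ._≤ h ℕ.* 2) (sym s′≡p-s) (ℕ.m∸n≤m (h ℕ.* 2) s))
        +s′≡p-s : + s′ ≡ + p - + suc s
        +s′≡p-s = trans (cong +_ s′≡p-s) (sym (trans (ℤ.[+m]-[+n]≡m⊖n p (suc s)) (ℤ.⊖-≥ (ℕ.<⇒≤ s<p))))
        identity : ∀ P a u v K →
          a * (P - a) * (u * u + v * v) - - (+ 2 * (K * K))
          ≡ - ((a * u - K) * (a * u + K) + ((P - a) * v - K) * ((P - a) * v + K) - (a * u * u + (P - a) * v * v) * P)
        identity = solve-∀

      p∤c : ¬ + p ∣ c
      p∤c = ∤*∤⇒∤ pp p∤2 (∤*∤⇒∤ pp (∤[p-1]! pp) (∤[p-1]! pp)) ∘ subst (+ p ∣_) (ℤ.neg-involutive _) ∘ ∣m⇒∣-m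
        where
        p∤2 : ¬ + p ∣ + 2
        p∤2 = ℕ.>⇒∤ (s≤s (ℕ.*-monoˡ-≤ 2 (ℕ.≤-trans (s≤s z≤n) 2≤h))) ∘ ∣⇒∣ᵤ

    p∣linearCoefficient : + p ∣ linearCoefficient h (pair (+ p))
    p∣linearCoefficient = [ ⊥-elim ∘ p∤c , id ]′ (euclidsLemmaℤ pp c _ p∣cL)
      where
      cancel : ∀ a b → a - b + b ≡ a
      cancel = solve-∀
      p∣cL : + p ∣ c * linearCoefficient h (pair (+ p))
      p∣cL = subst (+ p ∣_) (cancel _ _)
        (∣m∣n⇒∣m+n (linearCoefficient-∑ h (pair (+ p)) z pair*z≡c) (∣n⇒∣m*n (∏ h (pair (+ p))) p∣∑z))

    block-symmetry : ∀ j l → (1ℤ + + j + + l) * (+ p) ^ 3 ∣ block p j - block p l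
    block-symmetry j l = ∣-trans (divides (+ j - + l) width)
      (subst₂ (λ u v → δ * + p ∣ u - v) (sym (pairing j)) (sym (pairing l))
        (subst (δ * + p ∣_) (cancel _ (δ * linearCoefficient h (pair (+ p))))
          (∣m∣n⇒∣m+n (∏-difference (p∣w j) (p∣w l) h (pair (+ p))) (*-monoʳ-∣ δ p∣linearCoefficient))))
      where
      x : ℕ → ℤ
      x j = + (p ℕ.* j)
      w : ℕ → ℤ
      w j = x j * (x j + + p)
      δ = w j - w l
      p∣w : ∀ j → + p ∣ w j
      p∣w j = ∣m⇒∣m*n {m = x j} (x j + + p) (∣ᵤ⇒∣ (ℕ.m∣m*n j))
      pairing : ∀ j → block p j ≡ ∏ h (λ s → w j + pair (+ p) s)
      pairing j = rising-pairing h (x j)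
      cancel : ∀ a b → a - b + b ≡ a
      cancel = solve-∀
      width : δ * + p ≡ (+ j - + l) * ((1ℤ + + j + + l) * (+ p) ^ 3)
      width = trans (cong₂ (λ u v → (u * (u + + p) - v * (v + + p)) * + p) (ℤ.pos-* p j) (ℤ.pos-* p l))
                    (factorise (+ p) (+ j) (+ l))
        where
        factorise : ∀ P j l → (P * j * (P * j + P) - P * l * (P * l + P)) * P
                              ≡ (j - l) * ((+ 1 + j + l) * (P * (P * (P * + 1))))
        factorise = solve-∀

  -- The blocks for p = 3

  block-3 : ∀ n → block 3 n ≡ (+ 3 * + n + + 1) * (+ 3 * + n + + 2)
  block-3 n = trans (cong (λ x → (x + + 1) * ((x + + 2) * 1ℤ)) (ℤ.pos-* 3 n))
                    (cong ((+ 3 * + n + + 1) *_) (ℤ.*-identityʳ _))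

  block-3-symmetry : ∀ j l → (1ℤ + + j + + l) * (+ 3) ^ 2 ∣ block 3 j - block 3 l
  block-3-symmetry j l = divides (+ j - + l) (trans (cong₂ _-_ (block-3 j) (block-3 l)) (factorise (+ j) (+ l)))
    where
    factorise : ∀ j l → (+ 3 * j + + 1) * (+ 3 * j + + 2) - (+ 3 * l + + 1) * (+ 3 * l + + 2)
                        ≡ (j - l) * ((+ 1 + j + l) * (+ 3 * (+ 3 * + 1)))
    factorise = solve-∀

  tripleBlock : ℕ → ℤ
  tripleBlock j = block 3 (j ℕ.* 3) * block 3 (suc (j ℕ.* 3)) * block 3 (suc (suc (j ℕ.* 3)))

  pFreeFactorial-3-grouped : ∀ n → pFreeFactorial 3 (suc n ℕ.* 3) ≡ pFreeFactorial 3 (n ℕ.* 3) * tripleBlock n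
  pFreeFactorial-3-grouped n = begin
    ∏ (suc (suc (suc (n ℕ.* 3)))) (block 3)
      ≡⟨ ∏-last (suc (suc (n ℕ.* 3))) (block 3) ⟩
    ∏ (suc (suc (n ℕ.* 3))) (block 3) * block 3 (suc (suc (n ℕ.* 3)))
      ≡⟨ cong (_* block 3 (suc (suc (n ℕ.* 3)))) (∏-last (suc (n ℕ.* 3)) (block 3)) ⟩
    ∏ (suc (n ℕ.* 3)) (block 3) * block 3 (suc (n ℕ.* 3)) * block 3 (suc (suc (n ℕ.* 3)))
      ≡⟨ cong (λ t → t * block 3 (suc (n ℕ.* 3)) * block 3 (suc (suc (n ℕ.* 3)))) (∏-last (n ℕ.* 3) (block 3)) ⟩
    ∏ (n ℕ.* 3) (block 3) * block 3 (n ℕ.* 3) * block 3 (suc (n ℕ.* 3)) * block 3 (suc (suc (n ℕ.* 3)))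
      ≡⟨ regroup (∏ (n ℕ.* 3) (block 3)) (block 3 (n ℕ.* 3)) _ _ ⟩
    ∏ (n ℕ.* 3) (block 3) * tripleBlock n
      ∎
    where
    open ≡-Reasoning
    regroup : ∀ a b c d → a * b * c * d ≡ a * (b * c * d)
    regroup = solve-∀

  tripleBlock-cubic : ∀ j → let w = + 81 * (+ j * (+ j + + 1)) in tripleBlock j ≡ (w + + 8) * (w + + 14) * (w + + 20)
  tripleBlock-cubic j = begin
    tripleBlock j
      ≡⟨ cong₂ (λ a b → a * b * block 3 (suc (suc (j ℕ.* 3)))) (block-3 (j ℕ.* 3)) (block-3 (suc (j ℕ.* 3))) ⟩
    q (+ (j ℕ.* 3)) * q (+ 1 + + (j ℕ.* 3)) * block 3 (suc (suc (j ℕ.* 3)))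
      ≡⟨ cong (q (+ (j ℕ.* 3)) * q (+ 1 + + (j ℕ.* 3)) *_) (block-3 (suc (suc (j ℕ.* 3)))) ⟩
    q (+ (j ℕ.* 3)) * q (+ 1 + + (j ℕ.* 3)) * q (+ 2 + + (j ℕ.* 3))
      ≡⟨ cong (λ y → q y * q (+ 1 + y) * q (+ 2 + y)) (ℤ.pos-* j 3) ⟩
    q (+ j * + 3) * q (+ 1 + + j * + 3) * q (+ 2 + + j * + 3)
      ≡⟨ pairUp (+ j) ⟩
    (+ 81 * (+ j * (+ j + + 1)) + + 8) * (+ 81 * (+ j * (+ j + + 1)) + + 14) * (+ 81 * (+ j * (+ j + + 1)) + + 20)
      ∎
    where
    open ≡-Reasoning
    q : ℤ → ℤ
    q y = (+ 3 * y + + 1) * (+ 3 * y + + 2)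
    pairUp : ∀ j → (+ 3 * (j * + 3) + + 1) * (+ 3 * (j * + 3) + + 2)
                   * ((+ 3 * (+ 1 + j * + 3) + + 1) * (+ 3 * (+ 1 + j * + 3) + + 2))
                   * ((+ 3 * (+ 2 + j * + 3) + + 1) * (+ 3 * (+ 2 + j * + 3) + + 2))
                   ≡ (+ 81 * (j * (j + + 1)) + + 8) * (+ 81 * (j * (j + + 1)) + + 14) * (+ 81 * (j * (j + + 1)) + + 20)
    pairUp = solve-∀

  tripleBlock-symmetry : ∀ j l → (1ℤ + + j + + l) * (+ 3) ^ 4 ∣ tripleBlock j - tripleBlock l
  tripleBlock-symmetry j l = divides ((+ j - + l) * Q) (begin
    tripleBlock j - tripleBlock l
      ≡⟨ cong₂ _-_ (tripleBlock-cubic j) (tripleBlock-cubic l) ⟩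
    (w j + + 8) * (w j + + 14) * (w j + + 20) - (w l + + 8) * (w l + + 14) * (w l + + 20)
      ≡⟨ differenceOfCubics (w j) (w l) ⟩
    (w j - w l) * Q
      ≡⟨ cong (_* Q) (differenceOfW (+ j) (+ l)) ⟩
    (+ j - + l) * (+ 1 + + j + + l) * + 81 * Q
      ≡⟨ regroup (+ j - + l) (+ 1 + + j + + l) Q ⟩
    (+ j - + l) * Q * ((1ℤ + + j + + l) * (+ 3) ^ 4)
      ∎)
    where
    open ≡-Reasoning
    w : ℕ → ℤ
    w j = + 81 * (+ j * (+ j + + 1))
    Q = w j * w j + w j * w l + w l * w l + + 42 * (w j + w l) + + 552
    differenceOfCubics : ∀ a b → (a + + 8) * (a + + 14) * (a + + 20) - (b + + 8) * (b + + 14) * (b + + 20)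
                                 ≡ (a - b) * (a * a + a * b + b * b + + 42 * (a + b) + + 552)
    differenceOfCubics = solve-∀
    differenceOfW : ∀ j l → + 81 * (j * (j + + 1)) - + 81 * (l * (l + + 1)) ≡ (j - l) * (+ 1 + j + l) * + 81
    differenceOfW = solve-∀
    regroup : ∀ d e Q → d * e * + 81 * Q ≡ d * Q * (e * + 81)
    regroup = solve-∀

  absorption : ∀ i k → + suc i * + ((suc i ℕ.+ k) C suc i) ≡ + (suc i ℕ.+ k) * + ((i ℕ.+ k) C i)
  absorption i k = ℤ.*-cancelʳ-≡ (+ suc i * + ((suc i ℕ.+ k) C suc i)) (+ (suc i ℕ.+ k) * + ((i ℕ.+ k) C i))
                     (+ (i !) * + (k !)) {{ℤ.i*j≢0 (+ (i !)) (+ (k !)) {{i !≢0}} {{k !≢0}}}} (begin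
    + suc i * + ((suc i ℕ.+ k) C suc i) * (+ (i !) * + (k !))
      ≡⟨ regroup (+ suc i) (+ ((suc i ℕ.+ k) C suc i)) (+ (i !)) (+ (k !)) ⟩
    + ((suc i ℕ.+ k) C suc i) * ((+ suc i * + (i !)) * + (k !))
      ≡⟨ cong (λ t → + ((suc i ℕ.+ k) C suc i) * (t * + (k !))) (ℤ.pos-* (suc i) (i !)) ⟨
    + ((suc i ℕ.+ k) C suc i) * (+ (suc i !) * + (k !))
      ≡⟨ binomial-factorials (suc i) k ⟩
    + ((suc i ℕ.+ k) !)
      ≡⟨ ℤ.pos-* (suc i ℕ.+ k) ((i ℕ.+ k) !) ⟩
    + (suc i ℕ.+ k) * + ((i ℕ.+ k) !)
      ≡⟨ cong (+ (suc i ℕ.+ k) *_) (binomial-factorials i k) ⟨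
    + (suc i ℕ.+ k) * (+ ((i ℕ.+ k) C i) * (+ (i !) * + (k !)))
      ≡⟨ ℤ.*-assoc (+ (suc i ℕ.+ k)) (+ ((i ℕ.+ k) C i)) (+ (i !) * + (k !)) ⟨
    + (suc i ℕ.+ k) * + ((i ℕ.+ k) C i) * (+ (i !) * + (k !))
      ∎)
    where
    open ≡-Reasoning
    regroup : ∀ a c f g → a * c * (f * g) ≡ c * (a * f * g)
    regroup = solve-∀

  ∣m∧∤mCi⇒∣i : ∀ {p} → Prime p → ∀ i k → p ℕ.∣ i ℕ.+ k → ¬ p ℕ.∣ (i ℕ.+ k) C i → p ℕ.∣ i
  ∣m∧∤mCi⇒∣i {p} pp zero    k _    _   = p ℕ.∣0
  ∣m∧∤mCi⇒∣i {p} pp (suc i) k p∣m p∤C = [ ∣⇒∣ᵤ , ⊥-elim ∘ p∤C ∘ ∣⇒∣ᵤ ]′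
    (euclidsLemmaℤ pp (+ suc i) (+ ((suc i ℕ.+ k) C suc i))
      (subst (+ p ∣_) (sym (absorption i k)) (∣m⇒∣m*n (+ ((i ℕ.+ k) C i)) (∣ᵤ⇒∣ {+ p} {+ (suc i ℕ.+ k)} p∣m))))

  binomial-congruence-≥5 : ∀ {h} → Prime (suc (h ℕ.* 2)) → 2 ℕ.≤ h → ∀ {a b} i k →
    suc (h ℕ.* 2) ℕ.^ a ℕ.∣ i ℕ.+ k → suc (h ℕ.* 2) ℕ.^ b ℕ.∣ (i ℕ.+ k) C i →
    (suc (h ℕ.* 2) ℕ.* (i ℕ.+ k)) C (suc (h ℕ.* 2) ℕ.* i) ≡ (i ℕ.+ k) C i [mod suc (h ℕ.* 2) ℕ.^ (b ℕ.+ (a ℕ.+ 3)) ]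
  binomial-congruence-≥5 {h} pp 2≤h {a} {b} i k pᵃ∣m pᵇ∣C = pFree⇒binomial-congruence pp {b} i k pᵇ∣C
    (telescope-^ (pFreeFactorial p) (block p) refl (λ n → ∏-last n (block p)) {p} (block-symmetry pp 2≤h) {a} pᵃ∣m i k refl)
    where p = suc (h ℕ.* 2)

  binomial-congruence-3 : Prime 3 → ∀ {a b} i k → 3 ℕ.^ a ℕ.∣ i ℕ.+ k → 3 ℕ.^ b ℕ.∣ (i ℕ.+ k) C i →
    (3 ℕ.* (i ℕ.+ k)) C (3 ℕ.* i) ≡ (i ℕ.+ k) C i [mod 3 ℕ.^ (b ℕ.+ (a ℕ.+ 2)) ]
  binomial-congruence-3 pp {a} {b} i k 3ᵃ∣m 3ᵇ∣C = pFree⇒binomial-congruence pp {b} i k 3ᵇ∣C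
    (telescope-^ (pFreeFactorial 3) (block 3) refl (λ n → ∏-last n (block 3)) {3} block-3-symmetry {a} 3ᵃ∣m i k refl)

  binomial-congruence-3-grouped : Prime 3 → ∀ {a b} i k → 3 ℕ.^ a ℕ.∣ i ℕ.+ k →
    3 ℕ.^ b ℕ.∣ (i ℕ.* 3 ℕ.+ k ℕ.* 3) C (i ℕ.* 3) →
    (3 ℕ.* (i ℕ.* 3 ℕ.+ k ℕ.* 3)) C (3 ℕ.* (i ℕ.* 3)) ≡ (i ℕ.* 3 ℕ.+ k ℕ.* 3) C (i ℕ.* 3) [mod 3 ℕ.^ (b ℕ.+ (a ℕ.+ 4)) ]
  binomial-congruence-3-grouped pp {a} {b} i k 3ᵃ∣m 3ᵇ∣C =
    pFree⇒binomial-congruence pp {b} (i ℕ.* 3) (k ℕ.* 3) 3ᵇ∣C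
    (subst (λ n → (+ 3) ^ (a ℕ.+ 4) ∣ pFreeFactorial 3 n - pFreeFactorial 3 (i ℕ.* 3) * pFreeFactorial 3 (k ℕ.* 3))
      (ℕ.*-distribʳ-+ 3 i k)
      (telescope-^ (λ n → pFreeFactorial 3 (n ℕ.* 3)) tripleBlock refl pFreeFactorial-3-grouped
        {3} tripleBlock-symmetry {a} 3ᵃ∣m i k refl))

open import Data.Nat using (ℕ; _+_; _*_; _∸_; _^_; _≤_; _≥_)
open import Data.Nat.Primality using (Prime)
open import Data.Nat.Combinatorics using (_C_)
open import Data.Nat.Tactic.RingSolver using (solve-∀)

^-monoʳ-∣ : ∀ p {e f} → e ≤ f → p ^ e ℕ.∣ p ^ f
^-monoʳ-∣ p {e} e≤f with ℕ.m≤n⇒∃[o]m+o≡n e≤f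
... | d , refl = subst (p ^ e ℕ.∣_) (sym (ℕ.^-distribˡ-+-* p e d)) (ℕ.m∣m*n (p ^ d))

odd-prime : ∀ {p} → Prime p → p ≥ 3 → ∃ λ h → p ≡ suc (h * 2)
odd-prime {p} pp p≥3 with p % 2 | m%n<n p 2 | m≡m%n+[m/n]*n p 2
... | 1           | _            | p≡1+2h = p / 2 , p≡1+2h
... | suc (suc _) | s≤s (s≤s ()) | _
... | 0           | _            | p≡2h with prime⇒irreducible pp (ℕ.divides (p / 2) p≡2h)
...   | inj₁ ()
...   | inj₂ refl = ⊥-elim (ℕ.<⇒≱ p≥3 ℕ.≤-refl)

binomial-congruence-3-χ : Prime 3 → ∀ a b i k → 3 ^ a ℕ.∣ i + k → 3 ^ b ℕ.∣ (i + k) C i → ¬ 3 ^ suc b ℕ.∣ (i + k) C i →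
  (3 * (i + k)) C (3 * i) ≡ (i + k) C i [mod 3 ^ (a + b + 3 ∸ chi 3 a b) ]
binomial-congruence-3-χ pp zero    b       i k 3ᵃ∣m 3ᵇ∣C _ =
  ℕ.∣-trans (^-monoʳ-∣ 3 (ℕ.≤-reflexive (ℕ.+-∸-assoc b (s≤s z≤n)))) (binomial-congruence-3 pp {0} {b} i k 3ᵃ∣m 3ᵇ∣C)
binomial-congruence-3-χ pp (suc a) (suc b) i k 3ᵃ∣m 3ᵇ∣C _ =
  ℕ.∣-trans (^-monoʳ-∣ 3 (ℕ.≤-reflexive (exponent a b))) (binomial-congruence-3 pp {suc a} {suc b} i k 3ᵃ∣m 3ᵇ∣C)
  where
  exponent : ∀ a b → a + suc b + 3 ≡ suc b + (suc a + 2)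
  exponent = solve-∀
binomial-congruence-3-χ pp (suc a) zero i k 3ᵃ⁺¹∣m 3⁰∣C 3∤C
  with ∣m∧∤mCi⇒∣i pp i k (ℕ.m*n∣⇒m∣ 3 (3 ^ a) 3ᵃ⁺¹∣m) 3∤C
... | ℕ.divides i′ refl with ℕ.∣m+n∣m⇒∣n (ℕ.m*n∣⇒m∣ 3 (3 ^ a) 3ᵃ⁺¹∣m) (ℕ.n∣m*n i′)
... | ℕ.divides k′ refl =
  ℕ.∣-trans (^-monoʳ-∣ 3 (ℕ.≤-reflexive (exponent a))) (binomial-congruence-3-grouped pp {a} {0} i′ k′ 3ᵃ∣m′ 3⁰∣C)
  where
  exponent : ∀ a → suc a + 0 + 3 ≡ a + 4
  exponent = solve-∀
  3ᵃ∣m′ : 3 ^ a ℕ.∣ i′ + k′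
  3ᵃ∣m′ = ℕ.*-cancelʳ-∣ 3 (subst₂ ℕ._∣_ (ℕ.*-comm 3 (3 ^ a)) (sym (ℕ.*-distribʳ-+ 3 i′ k′)) 3ᵃ⁺¹∣m)

lemma5p1 : (p m i : ℕ) → Prime p → p ≥ 3 → m ≥ 1 → i ≤ m →
    (a b : ℕ) → IsValuation p m a → IsValuation p (m C i) b →
    (p * m) C (p * i) ≡ m C i [mod p ^ (a + b + 3 ∸ chi p a b) ]
lemma5p1 p m i pp p≥3 _ i≤m a b (pᵃ∣m , _) (pᵇ∣C , pᵇ⁺¹∤C)
  with ℕ.m≤n⇒∃[o]m+o≡n i≤m | odd-prime pp p≥3
... | k , refl | zero        , refl with s≤s () ← p≥3
... | k , refl | suc zero    , refl = binomial-congruence-3-χ pp a b i k pᵃ∣m pᵇ∣C pᵇ⁺¹∤C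
... | k , refl | suc (suc h) , refl =
  ℕ.∣-trans (^-monoʳ-∣ p (ℕ.≤-reflexive (exponent a b)))
    (binomial-congruence-≥5 {suc (suc h)} pp (s≤s (s≤s z≤n)) {a} {b} i k pᵃ∣m pᵇ∣C)
  where
  exponent : ∀ a b → a + b + 3 ≡ b + (a + 3)
  exponent = solve-∀
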